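{- Let $G$ be a finite group, $d$ a right-invariant metric on $G$, and let $\{P_0,P_1,\ldots,P_s\}$, with $P_0=\{e\}$, be the induced partition $P(G,d)$. Then $$\Gamma(G,d)=\bigcap_{1\le i\le s}\mathrm{Aut}\big(\mathrm{Cay}(G,P_i)\big).$$
   Context: A metric $d$ on a group $G$ is right-invariant if $d(gh,g'h)=d(g,g')$ for all $g,g',h\in G$. Its weight is $w(x)=d(x,e)$, and its induced partition $P(G,d)$ is the partition of $G$ into classes of the relation $g\sim h\iff w(g)=w(h)$; each part is closed under inversion and $\{e\}$ is a part. The symmetry group is $\Gamma(G,d)=\{\sigma\in\mathbb{S}_G: d(\sigma(x),\sigma(y))=d(x,y)\ \forall x,y\in G\}$, where $\mathbb{S}_G$ is the group of all permutations of the set $G$. For a subset $S\subseteq G$ with $e\notin S$ and $S=S^{ -1}$, the Cayley graph $\mathrm{Cay}(G,S)$ is the simple graph with vertex set $G$ in which $g,h$ are adjacent iff $gh^{ -1}\in S$; $\mathrm{Aut}(\mathrm{Cay}(G,S))\le\mathbb{S}_G$ is its group of graph automorphisms (adjacency-preserving permutations of $G$). -}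

module Defs where

open import Level using (Level; suc; _⊔_)
open import Data.Nat using (ℕ)
open import Data.Fin using (Fin)
open import Data.Product using (_×_)
open import Relation.Binary.PropositionalEquality using (_≡_)
open import Relation.Nullary using (¬_)
open import Function.Bundles using (_↔_; _⇔_; Inverse)
open import Algebra.Core using (Op₁; Op₂)
open import Algebra.Structures using (IsGroup)

record FiniteGroup (a : Level) : Set (suc a) where
  field
    Carrier  : Set a
    _∙_      : Op₂ Carrier
    e        : Carrier
    _⁻¹      : Op₁ Carrier
    isGroup  : IsGroup _≡_ _∙_ e _⁻¹
    size     : ℕ
    enum     : Fin size ↔ Carrier
  infixl 7 _∙_
  infix  8 _⁻¹

-- The codomain of a metric: a type with a zero, an addition and an order
-- (the reals with 0, +, ≤ being the case of the paper).
record DistanceValues (v : Level) : Set (suc v) where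
  field
    Value : Set v
    0#    : Value
    _+_   : Op₂ Value
    _≤_   : Value → Value → Set v

module _ {a v : Level} (G : FiniteGroup a) (V : DistanceValues v) where
  open FiniteGroup G
  open DistanceValues V

  IsMetric : (Carrier → Carrier → Value) → Set (a ⊔ v)
  IsMetric d =
      (∀ x y → (d x y ≡ 0# ⇔ x ≡ y))
    × (∀ x y → d x y ≡ d y x)
    × (∀ x y z → d x z ≤ (d x y + d y z))
    × (∀ x y → 0# ≤ d x y)

  IsRightInvariant : (Carrier → Carrier → Value) → Set (a ⊔ v)
  IsRightInvariant d = ∀ g g' h → d (g ∙ h) (g' ∙ h) ≡ d g g'

  weight : (Carrier → Carrier → Value) → Carrier → Value
  weight d x = d x e

  -- the part of the induced partition P(G,d) containing h
  PartOf : (Carrier → Carrier → Value) → Carrier → Carrier → Set v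
  PartOf d h g = weight d g ≡ weight d h

  IsIsometry : (Carrier → Carrier → Value) → Carrier ↔ Carrier → Set (a ⊔ v)
  IsIsometry d σ = ∀ x y → d (f x) (f y) ≡ d x y
    where open Inverse σ renaming (to to f) using ()

  CayAdj : ∀ {ℓ} → (Carrier → Set ℓ) → Carrier → Carrier → Set ℓ
  CayAdj S g h = S (g ∙ h ⁻¹)

  IsCayAut : ∀ {ℓ} → (Carrier → Set ℓ) → Carrier ↔ Carrier → Set (a ⊔ ℓ)
  IsCayAut S σ = ∀ x y → (CayAdj S x y ⇔ CayAdj S (f x) (f y))
    where open Inverse σ renaming (to to f) using ()

{-# OPTIONS --safe #-}
-- Right-invariance makes d x y = w (x y⁻¹), so σ is an isometry exactly when
-- w (σ x · σ y⁻¹) = w (x y⁻¹) for all x, y. For x ≠ y this says precisely that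
-- σ maps the edge (x, y) of Cay(G, P_i), with P_i the part of x y⁻¹, to an edge
-- of the same graph; for x = y both distances equal w e.
module Submission where

open import Defs
open import Level using (Level)
open import Algebra.Bundles using (Group)
open import Data.Fin.Properties using (_≟_)
open import Function.Base using (_∘_)
open import Function.Bundles using (_↔_; _⇔_; Inverse; Equivalence; mk⇔)
open import Function.Properties.Inverse using (↔-sym; ↔⇒↣)
open import Relation.Binary.Definitions using (DecidableEquality)
open import Relation.Binary.PropositionalEquality
open import Relation.Nullary using (¬_; yes; no)
open import Relation.Nullary.Decidable using (via-injection)

module _ {a : Level} (G : FiniteGroup a) where
  open FiniteGroup G

  group : Group a a
  group = record { isGroup = isGroup }

  ≡-dec : DecidableEquality Carrier
  ≡-dec = via-injection (↔⇒↣ (↔-sym enum)) _≟_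

module _ {a v : Level} (G : FiniteGroup a) (V : DistanceValues v)
         {d : FiniteGroup.Carrier G → FiniteGroup.Carrier G → DistanceValues.Value V}
         (rightInvariant : IsRightInvariant G V d) where
  open FiniteGroup G
  open Group (group G) using (identityˡ)
  open import Algebra.Properties.Group (group G) using (//-rightDividesˡ; x∙y⁻¹≈ε⇒x≈y)
  open ≡-Reasoning

  weight-∙⁻¹ : ∀ x y → weight G V d (x ∙ y ⁻¹) ≡ d x y
  weight-∙⁻¹ x y = begin
    d (x ∙ y ⁻¹) e          ≡⟨ rightInvariant (x ∙ y ⁻¹) e y ⟨
    d (x ∙ y ⁻¹ ∙ y) (e ∙ y) ≡⟨ cong₂ d (//-rightDividesˡ y x) (identityˡ y) ⟩
    d x y                    ∎

  diagonal-constant : ∀ x → d x x ≡ d e e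
  diagonal-constant x = begin
    d x x             ≡⟨ cong₂ d (identityˡ x) (identityˡ x) ⟨
    d (e ∙ x) (e ∙ x) ≡⟨ rightInvariant e e x ⟩
    d e e             ∎

  module _ (σ : Carrier ↔ Carrier) where
    open Inverse σ renaming (to to f) using ()

    isometry⇒cayAut : IsIsometry G V d σ → ∀ h → IsCayAut G V (PartOf G V d h) σ
    isometry⇒cayAut isometry h x y =
      mk⇔ (trans quotient-weight-preserved) (trans (sym quotient-weight-preserved))
      where
      quotient-weight-preserved : weight G V d (f x ∙ f y ⁻¹) ≡ weight G V d (x ∙ y ⁻¹)
      quotient-weight-preserved = begin
        weight G V d (f x ∙ f y ⁻¹) ≡⟨ weight-∙⁻¹ (f x) (f y) ⟩
        d (f x) (f y)               ≡⟨ isometry x y ⟩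
        d x y                       ≡⟨ weight-∙⁻¹ x y ⟨
        weight G V d (x ∙ y ⁻¹)     ∎

    cayAut⇒isometry : (∀ h → ¬ h ≡ e → IsCayAut G V (PartOf G V d h) σ)
                    → IsIsometry G V d σ
    cayAut⇒isometry cayAut x y with ≡-dec G x y
    ... | yes refl = trans (diagonal-constant (f x)) (sym (diagonal-constant x))
    ... | no x≢y = begin
      d (f x) (f y)               ≡⟨ weight-∙⁻¹ (f x) (f y) ⟨
      weight G V d (f x ∙ f y ⁻¹) ≡⟨ Equivalence.to (cayAut (x ∙ y ⁻¹) quotient≢e x y) refl ⟩
      weight G V d (x ∙ y ⁻¹)     ≡⟨ weight-∙⁻¹ x y ⟩
      d x y                       ∎
      where
      quotient≢e : ¬ x ∙ y ⁻¹ ≡ e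
      quotient≢e = x≢y ∘ x∙y⁻¹≈ε⇒x≈y x y

theorem3p5 : {a v : Level} (G : FiniteGroup a) (V : DistanceValues v)
    → (d : FiniteGroup.Carrier G → FiniteGroup.Carrier G → DistanceValues.Value V)
    → IsMetric G V d
    → IsRightInvariant G V d
    → (σ : FiniteGroup.Carrier G ↔ FiniteGroup.Carrier G)
    → IsIsometry G V d σ
      ⇔ (∀ (h : FiniteGroup.Carrier G) → ¬ (h ≡ FiniteGroup.e G)
           → IsCayAut G V (PartOf G V d h) σ)
theorem3p5 G V d _ rightInvariant σ =
  mk⇔ (λ isometry h _ → isometry⇒cayAut G V rightInvariant σ isometry h)
      (cayAut⇒isometry G V rightInvariant σ)
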